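{- $\mathrm{ex}'(n,\{\text{taco},\text{swords}\})\in O(n)$.
   Context: Let $P$ be a set of $n$ points in convex position in the plane (the vertices of a convex $n$-gon); a triangle on $P$ is a 3-element subset of $P$. For two distinct triangles $t_1,t_2$ on $P$, label each point of $t_1\cup t_2$ by the triangle(s) containing it and read the points in their cyclic order around the polygon. The pair forms exactly one of eight configurations. (i) If $t_1,t_2$ share two vertices $u,v$: "taco" if their third vertices lie on the same side of the line $uv$, "mariposa" if on opposite sides. (ii) If they share exactly one vertex $v$: read the remaining four vertices in cyclic order starting just after $v$; "bat" if the pattern is $t_1t_1t_2t_2$ or $t_2t_2t_1t_1$, "nested" if it is $t_1t_2t_2t_1$ or $t_2t_1t_1t_2$, "crossing" if it is $t_1t_2t_1t_2$ or $t_2t_1t_2t_1$. (iii) If they share no vertex, the cyclic sequence of the six labels is, up to rotation, reflection and exchanging the roles of $t_1,t_2$, one of: "ears" $AAABBB$, "swords" $AABABB$, "david" $ABABAB$. Top/bottom variant: partition the vertices of the convex $n$-gon by a horizontal line into a top half of $\lceil n/2\rceil$ vertices and a bottom half of $\lfloor n/2\rfloor$ vertices (each half consisting of consecutive vertices along the polygon). For a set $X$ of configurations, $\mathrm{ex}'(n,X)$ is the maximum size of a family of triangles on $P$, each having exactly two vertices in the top half and one vertex in the bottom half, in which no two triangles form a configuration belonging to $X$. -}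

module Defs where

open import Data.Nat using (ℕ; zero; suc; _+_; _*_; _<_; _≤_; _<ᵇ_; _≡ᵇ_; ⌈_/2⌉)
open import Data.Bool using (Bool; true; false; _∧_; _∨_; not; if_then_else_)
open import Data.List using (List; []; _∷_; _++_; map; concatMap; upTo; take; drop; reverse; length; filterᵇ)
open import Data.List.Membership.Propositional using (_∈_)
open import Data.List.Relation.Unary.All using (All)
open import Data.List.Relation.Unary.AllPairs using (AllPairs)
open import Data.Product using (_×_; ∃-syntax; _,_)
open import Relation.Binary.PropositionalEquality using (_≡_; _≢_)
open import Relation.Nullary using (¬_)

-- The n points of the convex n-gon are 0,1,...,n-1 in cyclic order.
-- A triangle is a 3-subset, represented canonically as a sorted triple a < b < c.
Tri : Set
Tri = ℕ × ℕ × ℕ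

IsTriangle : ℕ → Tri → Set
IsTriangle n (a , b , c) = a < b × b < c × c < n

memb : ℕ → Tri → Bool
memb v (a , b , c) = (v ≡ᵇ a) ∨ (v ≡ᵇ b) ∨ (v ≡ᵇ c)

vertsOf : Tri → List ℕ
vertsOf (a , b , c) = a ∷ b ∷ c ∷ []

inTop : ℕ → ℕ → Bool
inTop n v = v <ᵇ ⌈ n /2⌉

topCount : ℕ → Tri → ℕ
topCount n t = length (filterᵇ (inTop n) (vertsOf t))

bottomCount : ℕ → Tri → ℕ
bottomCount n t = length (filterᵇ (λ v → not (inTop n v)) (vertsOf t))

TopBottom : ℕ → Tri → Set
TopBottom n t = topCount n t ≡ 2 × bottomCount n t ≡ 1

-- w lies strictly inside the arc u < w < v (for u < v); the chord uv separates
-- the polygon vertices into this arc and its complement.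
inside : ℕ → ℕ → ℕ → Bool
inside u v w = (u <ᵇ w) ∧ (w <ᵇ v)

Taco : Tri → Tri → Set
Taco t₁ t₂ = t₁ ≢ t₂ × ∃[ u ] ∃[ v ] ∃[ w₁ ] ∃[ w₂ ]
  ( u < v
  × memb u t₁ ≡ true × memb u t₂ ≡ true
  × memb v t₁ ≡ true × memb v t₂ ≡ true
  × memb w₁ t₁ ≡ true × memb w₁ t₂ ≡ false
  × memb w₂ t₂ ≡ true × memb w₂ t₁ ≡ false
  × inside u v w₁ ≡ inside u v w₂ )

-- label sequence of the points of t₁ ∪ t₂ read in cyclic order
-- (true = point of t₁, false = point of t₂; used only for disjoint triangles)
labels : ℕ → Tri → Tri → List Bool
labels n t₁ t₂ = concatMap
  (λ i → if memb i t₁ then true ∷ [] else (if memb i t₂ then false ∷ [] else []))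
  (upTo n)

rotations : List Bool → List (List Bool)
rotations l = map (λ k → drop k l ++ take k l) (upTo (length l))

-- AABABB with A = true, B = false
swordsBase : List Bool
swordsBase = true ∷ true ∷ false ∷ true ∷ false ∷ false ∷ []

swordsPatterns : List (List Bool)
swordsPatterns =
  rotations swordsBase ++ rotations (reverse swordsBase) ++
  rotations (map not swordsBase) ++ rotations (map not (reverse swordsBase))

Disjoint : Tri → Tri → Set
Disjoint t₁ t₂ = ∀ v → ¬ (memb v t₁ ≡ true × memb v t₂ ≡ true)

Swords : ℕ → Tri → Tri → Set
Swords n t₁ t₂ = Disjoint t₁ t₂ × labels n t₁ t₂ ∈ swordsPatterns

Admissible : ℕ → List Tri → Set
Admissible n F =
  AllPairs _≢_ F
  × All (λ t → IsTriangle n t × TopBottom n t) F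
  × (∀ {t₁ t₂} → t₁ ∈ F → t₂ ∈ F → t₁ ≢ t₂ → ¬ Taco t₁ t₂ × ¬ Swords n t₁ t₂)

module Submission where

-- Every triangle (a , b , c) of an admissible family F has
-- a < b < ⌈n/2⌉ ≤ c.  Charge t = (a , b , c) to the key n + a if t has a left sibling (a
-- triangle of F with the same middle vertex b and a smaller first vertex), and to b otherwise.
-- No key is charged three times: two lonely triangles with equal b also share a (otherwise one
-- is the other's left sibling) and form a taco; among three triangles with left siblings and the
-- same a, the one (a , B , C) with largest middle vertex has a left sibling (a' , B , c'), every
-- other (a , b , c) with b < B has c = c' (else it forms swords with (a' , B , c')), so the
-- remaining two share a and c and form a taco.  Keys lie below 2n, so a general counting lemma
-- gives |F| ≤ 4n.

open import Defs
open import Data.Nat using (ℕ; zero; suc; _+_; _*_; _<_; _≤_; _<ᵇ_; _≡ᵇ_; ⌈_/2⌉; z≤n; s≤s)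
open import Data.Nat.Properties
open import Data.Nat.ListAction using (sum)
open import Data.Bool using (Bool; true; false; _∧_; _∨_; if_then_else_)
open import Data.Bool.Properties using (T-≡; ∨-zeroʳ; ∧-zeroʳ) renaming (_≟_ to _≟ᵇ_)
open import Data.List using (List; []; _∷_; _++_; concatMap; upTo; applyUpTo; map; length; filter; filterᵇ)
open import Data.List.Properties using (≡-dec)
open import Data.List.Relation.Unary.All as All using (All; []; _∷_)
open import Data.List.Relation.Unary.Any using (Any; here; there; any?)
open import Data.List.Relation.Unary.AllPairs using (AllPairs; []; _∷_)
import Data.List.Relation.Unary.AllPairs.Properties as AllPairs
open import Data.List.Relation.Unary.Linked using (Linked; []; [-]; _∷_) renaming (tail to linked-tail)
open import Data.List.Relation.Unary.Linked.Properties using (Linked⇒All)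
open import Data.List.Relation.Binary.Pointwise using (Pointwise; []; _∷_)
open import Data.List.Relation.Binary.Subset.Propositional using (_⊆_)
open import Data.List.Membership.Propositional using (_∈_; _∉_; find; lose)
open import Data.List.Membership.Propositional.Properties using (∈-filter⁻)
open import Data.List.Membership.DecPropositional (≡-dec _≟ᵇ_) using (_∈?_)
open import Data.Product using (_×_; _,_; proj₁; proj₂; ∃-syntax)
open import Data.Sum using (_⊎_; inj₁; inj₂)
open import Data.Empty using (⊥; ⊥-elim)
open import Function.Bundles using (Equivalence)
open import Relation.Binary.PropositionalEquality
open import Relation.Binary.Definitions using (tri<; tri≈; tri>) renaming (Tri to Trichotomy)
open import Relation.Nullary using (¬_; Dec; yes; no)
open import Relation.Nullary.Decidable using (True; toWitness; _×-dec_)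
open import Relation.Nullary.Reflects using (ofʸ; ofⁿ)
open import Level using (0ℓ)
open import Relation.Unary using (Pred; Decidable)
open import Relation.Unary.Properties using (∁?)

≡ᵇ-refl : ∀ m → (m ≡ᵇ m) ≡ true
≡ᵇ-refl m = Equivalence.to T-≡ (≡⇒≡ᵇ m m refl)

≡ᵇ-sound : ∀ {m k} → (m ≡ᵇ k) ≡ true → m ≡ k
≡ᵇ-sound {m} {k} e = ≡ᵇ⇒≡ m k (Equivalence.from T-≡ e)

<ᵇ-complete : ∀ {m k} → m < k → (m <ᵇ k) ≡ true
<ᵇ-complete m<k = Equivalence.to T-≡ (<⇒<ᵇ m<k)

<ᵇ-refute : ∀ {m k} → k ≤ m → (m <ᵇ k) ≡ false
<ᵇ-refute {m} {k} k≤m with m <ᵇ k | <ᵇ-reflects-< m k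
... | true  | ofʸ m<k = ⊥-elim (<⇒≱ m<k k≤m)
... | false | _       = refl

memb-complete : ∀ {v} t → v ∈ vertsOf t → memb v t ≡ true
memb-complete (a , b , c) (here refl) rewrite ≡ᵇ-refl a = refl
memb-complete (a , b , c) (there (here refl)) rewrite ≡ᵇ-refl b = ∨-zeroʳ (b ≡ᵇ a)
memb-complete (a , b , c) (there (there (here refl))) rewrite ≡ᵇ-refl c =
  trans (cong ((c ≡ᵇ a) ∨_) (∨-zeroʳ (c ≡ᵇ b))) (∨-zeroʳ (c ≡ᵇ a))

memb-sound : ∀ {v} t → memb v t ≡ true → v ∈ vertsOf t
memb-sound {v} (a , b , c) e with v ≡ᵇ a in e₁ | v ≡ᵇ b in e₂ | v ≡ᵇ c in e₃
... | true  | _     | _    = here (≡ᵇ-sound e₁)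
... | false | true  | _    = there (here (≡ᵇ-sound e₂))
... | false | false | true = there (there (here (≡ᵇ-sound e₃)))

memb-absent : ∀ {v} t → v ∉ vertsOf t → memb v t ≡ false
memb-absent {v} t v∉t with memb v t in e
... | true  = ⊥-elim (v∉t (memb-sound t e))
... | false = refl

∉-vertsOf : ∀ {v a b c} → v ≢ a → v ≢ b → v ≢ c → v ∉ vertsOf (a , b , c)
∉-vertsOf v≢a _   _   (here e)                 = v≢a e
∉-vertsOf _   v≢b _   (there (here e))         = v≢b e
∉-vertsOf _   _   v≢c (there (there (here e))) = v≢c e

inside-between : ∀ {u v w} → u < w → w < v → inside u v w ≡ true
inside-between u<w w<v rewrite <ᵇ-complete u<w | <ᵇ-complete w<v = refl

inside-beyond : ∀ {u v w} → v < w → inside u v w ≡ false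
inside-beyond {u} {v} {w} v<w = trans (cong ((u <ᵇ w) ∧_) (<ᵇ-refute (<⇒≤ v<w))) (∧-zeroʳ (u <ᵇ w))

bit : Bool → ℕ
bit true  = 1
bit false = 0

length-filterᵇ : ∀ {A : Set} (p : A → Bool) xs → length (filterᵇ p xs) ≡ sum (map (λ x → bit (p x)) xs)
length-filterᵇ p []       = refl
length-filterᵇ p (x ∷ xs) with p x
... | true  = cong suc (length-filterᵇ p xs)
... | false = length-filterᵇ p xs

two-below-threshold : ∀ {h a b c} → a < b → b < c →
                      bit (a <ᵇ h) + (bit (b <ᵇ h) + (bit (c <ᵇ h) + 0)) ≡ 2 → b < h × h ≤ c
two-below-threshold {h} {a} {b} {c} a<b b<c
  with a <ᵇ h | <ᵇ-reflects-< a h | b <ᵇ h | <ᵇ-reflects-< b h | c <ᵇ h | <ᵇ-reflects-< c h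
... | _     | _        | true  | ofʸ b<h  | false | ofⁿ c≮h = λ _ → b<h , ≮⇒≥ c≮h
... | false | ofⁿ a≮h  | _     | _        | true  | ofʸ c<h = ⊥-elim (a≮h (<-trans a<b (<-trans b<c c<h)))
... | true  | _        | false | ofⁿ b≮h  | true  | ofʸ c<h = ⊥-elim (b≮h (<-trans b<c c<h))
... | true  | _        | true  | _        | true  | _       = λ ()
... | true  | _        | false | _        | false | _       = λ ()
... | false | _        | false | _        | false | _       = λ ()

record Shape (n a b c : ℕ) : Set where
  field
    a<b : a < b
    b<c : b < c
    c<n : c < n
    b<h : b < ⌈ n /2⌉
    h≤c : ⌈ n /2⌉ ≤ c

shape : ∀ {n a b c} → IsTriangle n (a , b , c) → TopBottom n (a , b , c) → Shape n a b c
shape {n} {a} {b} {c} (a<b , b<c , c<n) (two-top , _) =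
  record { a<b = a<b ; b<c = b<c ; c<n = c<n ; b<h = proj₁ split ; h≤c = proj₂ split }
  where
    split : b < ⌈ n /2⌉ × ⌈ n /2⌉ ≤ c
    split = two-below-threshold a<b b<c (trans (sym (length-filterᵇ (inTop n) (vertsOf (a , b , c)))) two-top)

-- Triangles sharing their two smallest vertices a < b: both third vertices lie beyond b.
taco-shared-pair : ∀ {a b c c'} → a < b → b < c → b < c' → c ≢ c' → Taco (a , b , c) (a , b , c')
taco-shared-pair {a} {b} {c} {c'} a<b b<c b<c' c≢c' =
  (λ e → c≢c' (cong (λ t → proj₂ (proj₂ t)) e)) ,
  a , b , c , c' , a<b ,
  memb-complete t₁ (here refl) , memb-complete t₂ (here refl) ,
  memb-complete t₁ (there (here refl)) , memb-complete t₂ (there (here refl)) ,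
  memb-complete t₁ (there (there (here refl))) ,
  memb-absent t₂ (∉-vertsOf (>⇒≢ (<-trans a<b b<c)) (>⇒≢ b<c) c≢c') ,
  memb-complete t₂ (there (there (here refl))) ,
  memb-absent t₁ (∉-vertsOf (>⇒≢ (<-trans a<b b<c')) (>⇒≢ b<c') (≢-sym c≢c')) ,
  trans (inside-beyond b<c) (sym (inside-beyond b<c'))
  where
    t₁ t₂ : Tri
    t₁ = a , b , c
    t₂ = a , b , c'

-- Triangles sharing their outer vertices a < c: both middle vertices lie between a and c.
taco-shared-ends : ∀ {a b b' c} → a < b → b < c → a < b' → b' < c → b ≢ b' → Taco (a , b , c) (a , b' , c)
taco-shared-ends {a} {b} {b'} {c} a<b b<c a<b' b'<c b≢b' =
  (λ e → b≢b' (cong (λ t → proj₁ (proj₂ t)) e)) ,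
  a , c , b , b' , <-trans a<b b<c ,
  memb-complete t₁ (here refl) , memb-complete t₂ (here refl) ,
  memb-complete t₁ (there (there (here refl))) , memb-complete t₂ (there (there (here refl))) ,
  memb-complete t₁ (there (here refl)) ,
  memb-absent t₂ (∉-vertsOf (>⇒≢ a<b) b≢b' (<⇒≢ b<c)) ,
  memb-complete t₂ (there (here refl)) ,
  memb-absent t₁ (∉-vertsOf (>⇒≢ a<b') (≢-sym b≢b') (<⇒≢ b'<c)) ,
  trans (inside-between a<b b<c) (sym (inside-between a<b' b'<c))
  where
    t₁ t₂ : Tri
    t₁ = a , b , c
    t₂ = a , b' , c

-- The contribution of point i to labels n t₁ t₂ (definitionally the function mapped there).
-- Vertices of t₁ read as true, the remaining vertices of t₂ as false.
label : Tri → Tri → ℕ → List Bool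
label t₁ t₂ i = if memb i t₁ then true ∷ [] else (if memb i t₂ then false ∷ [] else [])

label-t₁ : ∀ {t₁ t₂ i} → i ∈ vertsOf t₁ → label t₁ t₂ i ≡ true ∷ []
label-t₁ {t₁} i∈t₁ rewrite memb-complete t₁ i∈t₁ = refl

label-t₂ : ∀ {t₁ t₂ i} → Disjoint t₁ t₂ → i ∈ vertsOf t₂ → label t₁ t₂ i ≡ false ∷ []
label-t₂ {t₁} {t₂} {i} disjoint i∈t₂ with memb i t₁ in e
... | true  = ⊥-elim (disjoint i (e , memb-complete t₂ i∈t₂))
... | false rewrite memb-complete t₂ i∈t₂ = refl

window : ℕ → ℕ → List ℕ
window s zero    = []
window s (suc k) = s ∷ window (suc s) k

applyUpTo-window : ∀ (f : ℕ → ℕ) s k → (∀ i → f i ≡ s + i) → applyUpTo f k ≡ window s k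
applyUpTo-window f s zero    _  = refl
applyUpTo-window f s (suc k) fi =
  cong₂ _∷_ (trans (fi 0) (+-identityʳ s))
            (applyUpTo-window (λ i → f (suc i)) (suc s) k (λ i → trans (fi (suc i)) (+-suc s i)))

upTo-window : ∀ n → upTo n ≡ window 0 n
upTo-window n = applyUpTo-window (λ i → i) 0 n (λ _ → refl)

head-below : ∀ {p ps} → Linked _<_ (p ∷ ps) → All (p <_) ps
head-below [-]            = []
head-below (p<q ∷ sorted) = Linked⇒All <-trans p<q sorted

scan : ∀ {A : Set} (f : ℕ → List A) k s {e} → s + k ≡ e → ∀ ps → Linked _<_ ps →
       All (s ≤_) ps → All (_< e) ps → (∀ i → s ≤ i → i ∉ ps → f i ≡ []) →
       concatMap f (window s k) ≡ concatMap f ps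
scan f zero    s _     []       _      _           _          _      = refl
scan f zero    s s+0≡e (p ∷ _)  _      (s≤p ∷ _)  (p<e ∷ _)  _      =
  ⊥-elim (<⇒≱ p<e (subst (_≤ p) (trans (sym (+-identityʳ s)) s+0≡e) s≤p))
scan f (suc k) s s+k≡e []       _      _           _          vanish =
  cong₂ _++_ (vanish s ≤-refl (λ ()))
             (scan f k (suc s) (trans (sym (+-suc s k)) s+k≡e) [] [] [] []
                   (λ i s<i i∉ → vanish i (<⇒≤ s<i) i∉))
scan f (suc k) s s+k≡e (p ∷ ps) sorted (s≤p ∷ _) below@(_ ∷ ps<e) vanish with s ≟ p
... | yes refl =
  cong (f s ++_) (scan f k (suc s) (trans (sym (+-suc s k)) s+k≡e) ps (linked-tail sorted)
                       (head-below sorted) ps<e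
                       (λ i s<i i∉ps → vanish i (<⇒≤ s<i) λ { (here i≡s) → >⇒≢ s<i i≡s ; (there i∈ps) → i∉ps i∈ps }))
... | no s≢p =
  cong₂ _++_ (vanish s ≤-refl (λ s∈ → <-irrefl refl (All.lookup s<all s∈)))
             (scan f k (suc s) (trans (sym (+-suc s k)) s+k≡e) (p ∷ ps) sorted s<all below
                   (λ i s<i i∉ → vanish i (<⇒≤ s<i) i∉))
  where
    s<p : s < p
    s<p = ≤∧≢⇒< s≤p s≢p
    s<all : All (s <_) (p ∷ ps)
    s<all = s<p ∷ All.map (<-trans s<p) (head-below sorted)

labels-along : ∀ {n} t₁ t₂ ps → Linked _<_ ps → All (_< n) ps → vertsOf t₁ ⊆ ps → vertsOf t₂ ⊆ ps →
               labels n t₁ t₂ ≡ concatMap (label t₁ t₂) ps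
labels-along {n} t₁ t₂ ps sorted below t₁⊆ps t₂⊆ps = begin
  labels n t₁ t₂                        ≡⟨ cong (concatMap (label t₁ t₂)) (upTo-window n) ⟩
  concatMap (label t₁ t₂) (window 0 n)  ≡⟨ scan (label t₁ t₂) n 0 refl ps sorted (All.tabulate (λ _ → z≤n)) below off-ps ⟩
  concatMap (label t₁ t₂) ps            ∎
  where
    open ≡-Reasoning
    off-ps : ∀ i → 0 ≤ i → i ∉ ps → label t₁ t₂ i ≡ []
    off-ps i _ i∉ps rewrite memb-absent t₁ (λ i∈t₁ → i∉ps (t₁⊆ps i∈t₁))
                          | memb-absent t₂ (λ i∈t₂ → i∉ps (t₂⊆ps i∈t₂)) = refl

concatMap-singletons : ∀ {A B : Set} {f : A → List B} {xs ys} →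
                       Pointwise (λ x y → f x ≡ y ∷ []) xs ys → concatMap f xs ≡ ys
concatMap-singletons []         = refl
concatMap-singletons (fx ∷ fxs) = cong₂ _++_ fx (concatMap-singletons fxs)

sword-pattern : (ℓs : List Bool) → {True (ℓs ∈? swordsPatterns)} → ℓs ∈ swordsPatterns
sword-pattern ℓs {found} = toWitness found

-- Interleaved triangles (a' , B , c') and (a , b , c), a' < a < b < B < c', c with c' ≠ c, form
-- swords: reading around the polygon gives ABBA followed by AB or BA.
swords-interleaved : ∀ {n a' a b B c' c} → a' < a → a < b → b < B → B < c' → B < c → c' ≢ c →
                     c' < n → c < n → Swords n (a' , B , c') (a , b , c)
swords-interleaved {n} {a'} {a} {b} {B} {c'} {c} a'<a a<b b<B B<c' B<c c'≢c c'<n c<n = by-order (<-cmp c' c)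
  where
    t₁ t₂ : Tri
    t₁ = a' , B , c'
    t₂ = a , b , c
    a<B = <-trans a<b b<B
    a'<B = <-trans a'<a a<B
    B<n = <-trans B<c c<n
    below : ∀ {p} → p < B → p < n
    below p<B = <-trans p<B B<n
    vertex₁ : ∀ {x y z : ℕ} → x ∈ x ∷ y ∷ z ∷ []
    vertex₁ = here refl
    vertex₂ : ∀ {x y z : ℕ} → y ∈ x ∷ y ∷ z ∷ []
    vertex₂ = there (here refl)
    vertex₃ : ∀ {x y z : ℕ} → z ∈ x ∷ y ∷ z ∷ []
    vertex₃ = there (there (here refl))
    disjoint : Disjoint t₁ t₂
    disjoint v (v∈t₁ , v∈t₂) with memb-sound {v} t₁ v∈t₁ | memb-sound {v} t₂ v∈t₂
    ... | here refl                 | here v≡a                 = <⇒≢ a'<a v≡a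
    ... | here refl                 | there (here v≡b)         = <⇒≢ (<-trans a'<a a<b) v≡b
    ... | here refl                 | there (there (here v≡c)) = <⇒≢ (<-trans a'<B B<c) v≡c
    ... | there (here refl)         | here v≡a                 = >⇒≢ a<B v≡a
    ... | there (here refl)         | there (here v≡b)         = >⇒≢ b<B v≡b
    ... | there (here refl)         | there (there (here v≡c)) = <⇒≢ B<c v≡c
    ... | there (there (here refl)) | here v≡a                 = >⇒≢ (<-trans a<B B<c') v≡a
    ... | there (there (here refl)) | there (here v≡b)         = >⇒≢ (<-trans b<B B<c') v≡b
    ... | there (there (here refl)) | there (there (here v≡c)) = c'≢c v≡c
    on₁ : ∀ {i} → i ∈ vertsOf t₁ → label t₁ t₂ i ≡ true ∷ []
    on₁ = label-t₁
    on₂ : ∀ {i} → i ∈ vertsOf t₂ → label t₁ t₂ i ≡ false ∷ []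
    on₂ = label-t₂ disjoint
    reading : ∀ ps {ℓs} → Linked _<_ ps → All (_< n) ps → vertsOf t₁ ⊆ ps → vertsOf t₂ ⊆ ps →
              Pointwise (λ i ℓ → label t₁ t₂ i ≡ ℓ ∷ []) ps ℓs → labels n t₁ t₂ ≡ ℓs
    reading ps sorted below-n t₁⊆ps t₂⊆ps labelled =
      trans (labels-along t₁ t₂ ps sorted below-n t₁⊆ps t₂⊆ps) (concatMap-singletons labelled)
    by-order : Trichotomy (c' < c) (c' ≡ c) (c < c') → Swords n t₁ t₂
    by-order (tri< c'<c _ _) =
      disjoint ,
      subst (_∈ swordsPatterns)
        (sym (reading (a' ∷ a ∷ b ∷ B ∷ c' ∷ c ∷ []) (a'<a ∷ a<b ∷ b<B ∷ B<c' ∷ c'<c ∷ [-])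
                      (below a'<B ∷ below a<B ∷ below b<B ∷ B<n ∷ c'<n ∷ c<n ∷ [])
                      (λ { (here refl) → here refl ; (there (here refl)) → there (there (there (here refl)))
                         ; (there (there (here refl))) → there (there (there (there (here refl)))) })
                      (λ { (here refl) → there (here refl) ; (there (here refl)) → there (there (here refl))
                         ; (there (there (here refl))) → there (there (there (there (there (here refl))))) })
                      (on₁ vertex₁ ∷ on₂ vertex₁ ∷ on₂ vertex₂ ∷ on₁ vertex₂ ∷ on₁ vertex₃ ∷ on₂ vertex₃ ∷ [])))
        (sword-pattern (true ∷ false ∷ false ∷ true ∷ true ∷ false ∷ []))
    by-order (tri≈ _ c'≡c _) = ⊥-elim (c'≢c c'≡c)
    by-order (tri> _ _ c<c') =
      disjoint ,
      subst (_∈ swordsPatterns)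
        (sym (reading (a' ∷ a ∷ b ∷ B ∷ c ∷ c' ∷ []) (a'<a ∷ a<b ∷ b<B ∷ B<c ∷ c<c' ∷ [-])
                      (below a'<B ∷ below a<B ∷ below b<B ∷ B<n ∷ c<n ∷ c'<n ∷ [])
                      (λ { (here refl) → here refl ; (there (here refl)) → there (there (there (here refl)))
                         ; (there (there (here refl))) → there (there (there (there (there (here refl))))) })
                      (λ { (here refl) → there (here refl) ; (there (here refl)) → there (there (here refl))
                         ; (there (there (here refl))) → there (there (there (there (here refl)))) })
                      (on₁ vertex₁ ∷ on₂ vertex₁ ∷ on₂ vertex₂ ∷ on₁ vertex₂ ∷ on₂ vertex₃ ∷ on₁ vertex₃ ∷ [])))
        (sword-pattern (true ∷ false ∷ false ∷ true ∷ false ∷ true ∷ []))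

length-filter-split : ∀ {A : Set} {P : Pred A 0ℓ} (P? : Decidable P) xs →
                      length xs ≡ length (filter P? xs) + length (filter (∁? P?) xs)
length-filter-split P? []       = refl
length-filter-split P? (x ∷ xs) with P? x
... | yes _ = cong suc (length-filter-split P? xs)
... | no  _ = trans (cong suc (length-filter-split P? xs)) (sym (+-suc _ _))

module _ {A : Set} (key : A → ℕ) where

  AtMostTwoPerKey : List A → Set
  AtMostTwoPerKey L = ∀ {x y z} → x ∈ L → y ∈ L → z ∈ L → x ≢ y → x ≢ z → y ≢ z →
                      key x ≡ key y → key x ≡ key z → ⊥

  key-class-size : ∀ {L} k M → AllPairs _≢_ M → (∀ {x} → x ∈ M → x ∈ L × key x ≡ k) →
                   AtMostTwoPerKey L → length M ≤ 2
  key-class-size k []                _ _ _ = z≤n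
  key-class-size k (_ ∷ [])          _ _ _ = s≤s z≤n
  key-class-size k (_ ∷ _ ∷ [])      _ _ _ = s≤s (s≤s z≤n)
  key-class-size k (x ∷ y ∷ z ∷ _) ((x≢y ∷ x≢z ∷ _) ∷ (y≢z ∷ _) ∷ _) in-class at-most-two =
    ⊥-elim (at-most-two (proj₁ x∈) (proj₁ y∈) (proj₁ z∈) x≢y x≢z y≢z
                        (trans (proj₂ x∈) (sym (proj₂ y∈))) (trans (proj₂ x∈) (sym (proj₂ z∈))))
    where
      x∈ = in-class (here refl)
      y∈ = in-class (there (here refl))
      z∈ = in-class (there (there (here refl)))

  at-most-two-per-key : ∀ m L → AllPairs _≢_ L → All (λ x → key x < m) L → AtMostTwoPerKey L →
                        length L ≤ 2 * m
  at-most-two-per-key zero    []      _ _          _ = z≤n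
  at-most-two-per-key zero    (_ ∷ _) _ (() ∷ _)   _
  at-most-two-per-key (suc k) L distinct below at-most-two = begin
    length L                    ≡⟨ length-filter-split has-key-k? L ⟩
    length top + length rest    ≤⟨ +-mono-≤ top-size rest-size ⟩
    2 + 2 * k                   ≡⟨ sym (*-suc 2 k) ⟩
    2 * suc k                   ∎
    where
      open ≤-Reasoning
      has-key-k? : Decidable (λ x → key x ≡ k)
      has-key-k? x = key x ≟ k
      top  = filter has-key-k? L
      rest = filter (∁? has-key-k?) L
      from-rest : ∀ {x} → x ∈ rest → x ∈ L × key x ≢ k
      from-rest = ∈-filter⁻ (∁? has-key-k?)
      top-size : length top ≤ 2
      top-size = key-class-size k top (AllPairs.filter⁺ has-key-k? distinct) (∈-filter⁻ has-key-k?) at-most-two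
      rest-size : length rest ≤ 2 * k
      rest-size = at-most-two-per-key k rest (AllPairs.filter⁺ (∁? has-key-k?) distinct)
        (All.tabulate (λ x∈ → ≤∧≢⇒< (≤-pred (All.lookup below (proj₁ (from-rest x∈)))) (proj₂ (from-rest x∈))))
        (λ x∈ y∈ z∈ → at-most-two (proj₁ (from-rest x∈)) (proj₁ (from-rest y∈)) (proj₁ (from-rest z∈)))

largest-of-three : ∀ {x y z} → x ≢ y → x ≢ z → y ≢ z → (x < z × y < z) ⊎ (x < y × z < y) ⊎ (y < x × z < x)
largest-of-three {x} {y} {z} x≢y x≢z y≢z with <-cmp x y | <-cmp y z | <-cmp x z
... | tri≈ _ x≡y _ | _              | _              = ⊥-elim (x≢y x≡y)
... | _            | tri≈ _ y≡z _   | _              = ⊥-elim (y≢z y≡z)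
... | _            | _              | tri≈ _ x≡z _   = ⊥-elim (x≢z x≡z)
... | tri< x<y _ _ | tri< y<z _ _   | _              = inj₁ (<-trans x<y y<z , y<z)
... | tri< x<y _ _ | tri> _ _ z<y   | _              = inj₂ (inj₁ (x<y , z<y))
... | tri> _ _ y<x | _              | tri< x<z _ _   = inj₁ (x<z , <-trans y<x x<z)
... | tri> _ _ y<x | _              | tri> _ _ z<x   = inj₂ (inj₂ (y<x , z<x))

first middle : Tri → ℕ
first  (a , _ , _) = a
middle (_ , b , _) = b

module Charging (n : ℕ) (F : List Tri) (admissible : Admissible n F) where

  shape-in : ∀ {a b c} → (a , b , c) ∈ F → Shape n a b c
  shape-in t∈F with All.lookup (proj₁ (proj₂ admissible)) t∈F
  ... | is-triangle , top-bottom = shape is-triangle top-bottom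

  no-taco : ∀ {t₁ t₂} → t₁ ∈ F → t₂ ∈ F → t₁ ≢ t₂ → ¬ Taco t₁ t₂
  no-taco t₁∈F t₂∈F t₁≢t₂ = proj₁ (proj₂ (proj₂ admissible) t₁∈F t₂∈F t₁≢t₂)

  no-swords : ∀ {t₁ t₂} → t₁ ∈ F → t₂ ∈ F → t₁ ≢ t₂ → ¬ Swords n t₁ t₂
  no-swords t₁∈F t₂∈F t₁≢t₂ = proj₂ (proj₂ (proj₂ admissible) t₁∈F t₂∈F t₁≢t₂)

  middle-below : ∀ {t} → t ∈ F → middle t < n
  middle-below {_ , _ , _} t∈F = <-trans b<c c<n
    where open Shape (shape-in t∈F)

  first-below : ∀ {t} → t ∈ F → first t < n
  first-below {_ , _ , _} t∈F = <-trans (Shape.a<b (shape-in t∈F)) (middle-below t∈F)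

  top-pair-unique : ∀ {a b c c'} → (a , b , c) ∈ F → (a , b , c') ∈ F → (a , b , c) ≢ (a , b , c') → ⊥
  top-pair-unique t∈F t'∈F t≢t' =
    no-taco t∈F t'∈F t≢t'
      (taco-shared-pair (Shape.a<b (shape-in t∈F)) (Shape.b<c (shape-in t∈F)) (Shape.b<c (shape-in t'∈F))
                        (λ c≡c' → t≢t' (cong (λ w → _ , _ , w) c≡c')))

  LeftSibling : Tri → Tri → Set
  LeftSibling t t' = middle t' ≡ middle t × first t' < first t

  HasLeftSibling : Tri → Set
  HasLeftSibling t = Any (LeftSibling t) F

  has-left-sibling? : ∀ t → Dec (HasLeftSibling t)
  has-left-sibling? t = any? (λ t' → (middle t' ≟ middle t) ×-dec (first t' <? first t)) F

  key : Tri → ℕ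
  key t with has-left-sibling? t
  ... | yes _ = n + first t
  ... | no  _ = middle t

  key-sibling : ∀ {t} → HasLeftSibling t → key t ≡ n + first t
  key-sibling {t} has with has-left-sibling? t
  ... | yes _   = refl
  ... | no  has̸ = ⊥-elim (has̸ has)

  key-lonely : ∀ {t} → ¬ HasLeftSibling t → key t ≡ middle t
  key-lonely {t} has̸ with has-left-sibling? t
  ... | yes has = ⊥-elim (has̸ has)
  ... | no  _   = refl

  key-bound : ∀ {t} → t ∈ F → key t < 2 * n
  key-bound {t} t∈F with has-left-sibling? t
  ... | yes _ = +-monoʳ-< n (subst (first t <_) (sym (+-identityʳ n)) (first-below t∈F))
  ... | no  _ = <-≤-trans (middle-below t∈F) (m≤m+n n (n + 0))

  -- Equal keys carry left-sibling status over: lonely keys are below n, the others at least n.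
  key-sibling-transfer : ∀ {x y} → x ∈ F → y ∈ F → key x ≡ key y → HasLeftSibling x → HasLeftSibling y
  key-sibling-transfer {a , _ , _} {y} x∈F y∈F same has-x = by-decision (has-left-sibling? y)
    where
      open ≤-Reasoning
      by-decision : Dec (HasLeftSibling y) → HasLeftSibling y
      by-decision (yes has-y) = has-y
      by-decision (no has̸-y) = ⊥-elim (<⇒≱ (middle-below y∈F) (begin
        n         ≤⟨ m≤m+n n a ⟩
        n + a     ≡⟨ sym (key-sibling has-x) ⟩
        key _     ≡⟨ same ⟩
        key y     ≡⟨ key-lonely has̸-y ⟩
        middle y  ∎))

  outer-pair-unique : ∀ {a b b' c} → (a , b , c) ∈ F → (a , b' , c) ∈ F → (a , b , c) ≢ (a , b' , c) → ⊥
  outer-pair-unique t∈F t'∈F t≢t' =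
    no-taco t∈F t'∈F t≢t'
      (taco-shared-ends (Shape.a<b (shape-in t∈F)) (Shape.b<c (shape-in t∈F))
                        (Shape.a<b (shape-in t'∈F)) (Shape.b<c (shape-in t'∈F))
                        (λ b≡b' → t≢t' (cong (λ w → _ , w , _) b≡b')))

  -- Two triangles without left sibling have different middle vertices: with equal middle
  -- vertices, the one with larger first vertex would have the other as left sibling.
  lonely-unique : ∀ {x y} → x ∈ F → y ∈ F → x ≢ y → ¬ HasLeftSibling x → ¬ HasLeftSibling y →
                  middle x ≡ middle y → ⊥
  lonely-unique {a , b , c} {a' , b' , c'} x∈F y∈F x≢y lonely-x lonely-y refl with <-cmp a a'
  ... | tri< a<a' _ _ = lonely-y (lose x∈F (refl , a<a'))
  ... | tri≈ _ refl _ = top-pair-unique x∈F y∈F x≢y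
  ... | tri> _ _ a'<a = lonely-x (lose y∈F (refl , a'<a))

  follows : ∀ {a' B c' a b c} → (a' , B , c') ∈ F → (a , b , c) ∈ F → a' < a → b < B → c ≡ c'
  follows {a'} {B} {c'} {a} {b} {c} s∈F t∈F a'<a b<B with c' ≟ c
  ... | yes c'≡c = sym c'≡c
  ... | no  c'≢c = ⊥-elim (no-swords s∈F t∈F (λ s≡t → <⇒≢ a'<a (cong first s≡t))
                     (swords-interleaved a'<a (Shape.a<b t) b<B (Shape.b<c s)
                        (<-≤-trans (Shape.b<h s) (Shape.h≤c t)) c'≢c (Shape.c<n s) (Shape.c<n t)))
    where
      s = shape-in s∈F
      t = shape-in t∈F

  -- Below a triangle with a left sibling there is at most one triangle with the same first
  -- vertex: all of them follow the sibling, hence share their outer vertices.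
  below-sibling-unique : ∀ {a B C b₁ c₁ b₂ c₂} → HasLeftSibling (a , B , C) →
                         (a , b₁ , c₁) ∈ F → (a , b₂ , c₂) ∈ F → (a , b₁ , c₁) ≢ (a , b₂ , c₂) →
                         b₁ < B → b₂ < B → ⊥
  below-sibling-unique has t₁∈F t₂∈F t₁≢t₂ b₁<B b₂<B with find has
  ... | (_ , _ , _) , s∈F , refl , a'<a
      with follows s∈F t₁∈F a'<a b₁<B | follows s∈F t₂∈F a'<a b₂<B
  ...   | refl | refl = outer-pair-unique t₁∈F t₂∈F t₁≢t₂

  -- No three distinct triangles with left siblings share their first vertex: the one with the
  -- largest middle vertex has the other two below it.
  sibling-class : ∀ {x y z} → x ∈ F → y ∈ F → z ∈ F → x ≢ y → x ≢ z → y ≢ z →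
                  HasLeftSibling x → HasLeftSibling y → HasLeftSibling z →
                  first x ≡ first y → first x ≡ first z → ⊥
  sibling-class {_ , b₁ , c₁} {_ , b₂ , c₂} {_ , b₃ , c₃} x∈F y∈F z∈F x≢y x≢z y≢z has-x has-y has-z refl refl
    with largest-of-three (distinct-middle x∈F y∈F x≢y) (distinct-middle x∈F z∈F x≢z) (distinct-middle y∈F z∈F y≢z)
    where
      distinct-middle : ∀ {a b c b' c'} → (a , b , c) ∈ F → (a , b' , c') ∈ F → (a , b , c) ≢ (a , b' , c') → b ≢ b'
      distinct-middle t∈F t'∈F t≢t' refl = top-pair-unique t∈F t'∈F t≢t'
  ... | inj₁ (b₁<b₃ , b₂<b₃)        = below-sibling-unique {C = c₃} has-z x∈F y∈F x≢y b₁<b₃ b₂<b₃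
  ... | inj₂ (inj₁ (b₁<b₂ , b₃<b₂)) = below-sibling-unique {C = c₂} has-y x∈F z∈F x≢z b₁<b₂ b₃<b₂
  ... | inj₂ (inj₂ (b₂<b₁ , b₃<b₁)) = below-sibling-unique {C = c₁} has-x y∈F z∈F y≢z b₂<b₁ b₃<b₁

  -- The heart of the argument: no key is charged three times.  Equal keys force equal
  -- left-sibling status; lonely triangles then share a middle vertex, the others a first vertex.
  no-three-share-key : AtMostTwoPerKey key F
  no-three-share-key {x} {y} {z} x∈F y∈F z∈F x≢y x≢z y≢z kx≡ky kx≡kz = by-decision (has-left-sibling? x)
    where
      open ≡-Reasoning
      by-decision : Dec (HasLeftSibling x) → ⊥
      by-decision (no lonely-x) = lonely-unique x∈F y∈F x≢y lonely-x lonely-y (begin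
          middle x  ≡⟨ sym (key-lonely lonely-x) ⟩
          key x     ≡⟨ kx≡ky ⟩
          key y     ≡⟨ key-lonely lonely-y ⟩
          middle y  ∎)
        where
          lonely-y : ¬ HasLeftSibling y
          lonely-y has-y = lonely-x (key-sibling-transfer y∈F x∈F (sym kx≡ky) has-y)
      by-decision (yes has-x) =
        sibling-class x∈F y∈F z∈F x≢y x≢z y≢z has-x has-y has-z (same-first has-y kx≡ky) (same-first has-z kx≡kz)
        where
          has-y = key-sibling-transfer x∈F y∈F kx≡ky has-x
          has-z = key-sibling-transfer x∈F z∈F kx≡kz has-x
          same-first : ∀ {t} → HasLeftSibling t → key x ≡ key t → first x ≡ first t
          same-first {t} has-t kx≡kt =
            +-cancelˡ-≡ n (first x) (first t) (trans (sym (key-sibling has-x)) (trans kx≡kt (key-sibling has-t)))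

  size-bound : length F ≤ 4 * n
  size-bound = subst (length F ≤_) (sym (*-assoc 2 2 n))
    (at-most-two-per-key key (2 * n) F (proj₁ admissible) (All.tabulate key-bound) no-three-share-key)

theorem12 : ∃[ C ] ∃[ N ] (∀ (n : ℕ) → N ≤ n → ∀ (F : List Tri) → Admissible n F → length F ≤ C * n)
theorem12 = 4 , 0 , λ n _ F admissible → Charging.size-bound n F admissible
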